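{- Let $q$ be an integer with $q\geq 2$ and let $a_1=-\lfloor 2\sqrt{q}\rfloor$. If $-a_3=\lfloor 2\sqrt{q}^{\,3}\rfloor$, then $q$ is a square.
   Context: $\sqrt{q}>0$ and $a_3=a_1^3-3qa_1$ (equivalently $a_3=\alpha^3+\bar\alpha^3$ for $\alpha$ a root of $X^2-a_1X+q$). -}

module Defs where

open import Data.Nat using (ℕ; suc; _*_; _≤_; _<_)
open import Data.Product using (_×_)
open import Data.Integer as ℤ using (ℤ; +_)

IsFloorSqrt : ℕ → ℕ → Set
IsFloorSqrt x m = (m * m ≤ x) × (x < suc m * suc m)

-- ⌊2√q⌋ = ⌊√(4q)⌋ and ⌊2(√q)³⌋ = ⌊√(4q³)⌋.
-- a₁ = -⌊2√q⌋ ;  a₃ = a₁³ - 3 q a₁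
a₁ : ℕ → ℤ
a₁ m = ℤ.- (+ m)

a₃ : ℕ → ℤ → ℤ
a₃ q a = a ℤ.* a ℤ.* a ℤ.- (+ 3) ℤ.* (+ q) ℤ.* a

{-# OPTIONS --safe #-}
module Submission where

open import Defs
open import Data.Nat using (ℕ; _*_; _≤_)
open import Data.Product using (∃)
open import Data.Integer as ℤ using (+_)
open import Relation.Binary.PropositionalEquality using (_≡_)

open import Data.Nat using (suc; _<_; s≤s; z≤n)
import Data.Nat.Properties as ℕP
import Data.Nat.Tactic.RingSolver as ℕSolver
open import Data.Nat.Divisibility using (_∣_; divides)
open import Data.Nat.Primality using (euclidsLemma; prime[2])
open import Data.Integer using (0ℤ; -[1+_])
import Data.Integer.Properties as ℤP
open import Data.Integer.Tactic.RingSolver using (solve-∀)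
open import Data.Product using (_,_)
open import Data.Sum using (inj₁; inj₂; [_,_]′)
open import Data.Empty using (⊥-elim)
open import Relation.Binary.PropositionalEquality using (refl; sym; trans; cong; subst₂)

-- Write a = ⌊2√q⌋, so that -a₃ is a³ - 3qa.  If q is not a square then a² < 4q, and
-- 4q³ = (a³ - 3qa)² + (4q - a²)(a² - q)²  (the discriminant of the quadratic with roots α³, ᾱ³).
-- Since 4q - a² ≥ 1 and (a² - q)² - 2(a³ - 3qa) - 1 = (a² - q - 3a)² + 4a³ - 9a² - 1 > 0 for a ≥ 3,
-- this gives (a³ - 3qa + 1)² ≤ 4q³, so ⌊2√q³⌋ > -a₃.  The cases a ≤ 2 are checked by hand.

cubic-odd : ∀ Q a →
  ℤ.- ((ℤ.- a) ℤ.* (ℤ.- a) ℤ.* (ℤ.- a) ℤ.- + 3 ℤ.* Q ℤ.* (ℤ.- a)) ≡ a ℤ.* a ℤ.* a ℤ.- + 3 ℤ.* Q ℤ.* a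
cubic-odd = solve-∀

a₃-odd : ∀ q a → ℤ.- a₃ q (ℤ.- a) ≡ a₃ q a
a₃-odd q = cubic-odd (+ q)

-- The discriminant identity and the gap identity of the header combined, with 4q - a² written as
-- 1 + (4q - (1 + a²)) and a = 3 + t: every summand after the first is visibly nonnegative.
four-cube-certificate : ∀ Q T →
  let a = + 3 ℤ.+ T ; N = a ℤ.* a ℤ.* a ℤ.- + 3 ℤ.* Q ℤ.* a ; U = a ℤ.* a ℤ.- Q ; S = U ℤ.- + 3 ℤ.* a in
  + 4 ℤ.* (Q ℤ.* Q ℤ.* Q)
    ≡ (+ 1 ℤ.+ N) ℤ.* (+ 1 ℤ.+ N)
      ℤ.+ (S ℤ.* S ℤ.+ (+ 26 ℤ.+ T ℤ.* (+ 54 ℤ.+ T ℤ.* (+ 27 ℤ.+ + 4 ℤ.* T))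
      ℤ.+ (+ 4 ℤ.* Q ℤ.- (+ 1 ℤ.+ a ℤ.* a)) ℤ.* (U ℤ.* U)))
four-cube-certificate = solve-∀

0≤i⇒0≤j⇒0≤i*j : ∀ {i j} → 0ℤ ℤ.≤ i → 0ℤ ℤ.≤ j → 0ℤ ℤ.≤ i ℤ.* j
0≤i⇒0≤j⇒0≤i*j {i} 0≤i 0≤j =
  subst₂ ℤ._≤_ (ℤP.*-zeroʳ i) refl (ℤP.*-monoˡ-≤-nonNeg i {{ℤ.nonNegative 0≤i}} 0≤j)

0≤i*i : ∀ i → 0ℤ ℤ.≤ i ℤ.* i
0≤i*i (+ n)    = 0≤i⇒0≤j⇒0≤i*j {+ n} {+ n} (ℤ.+≤+ z≤n) (ℤ.+≤+ z≤n)
0≤i*i -[1+ n ] = ℤ.+≤+ z≤n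

[1+cubic]²≤4Q³ : ∀ Q T → 0ℤ ℤ.≤ T →
  let a = + 3 ℤ.+ T ; N = a ℤ.* a ℤ.* a ℤ.- + 3 ℤ.* Q ℤ.* a in
  + 1 ℤ.+ a ℤ.* a ℤ.≤ + 4 ℤ.* Q → (+ 1 ℤ.+ N) ℤ.* (+ 1 ℤ.+ N) ℤ.≤ + 4 ℤ.* (Q ℤ.* Q ℤ.* Q)
[1+cubic]²≤4Q³ Q T 0≤T 1+a²≤4Q =
  subst₂ ℤ._≤_ refl (sym (four-cube-certificate Q T)) (ℤP.i≤i+j _ _ {{ℤ.nonNegative remainder≥0}})
  where
  a = + 3 ℤ.+ T
  U = a ℤ.* a ℤ.- Q
  0≤c : ∀ c → 0ℤ ℤ.≤ + c
  0≤c _ = ℤ.+≤+ z≤n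
  P≥0 : 0ℤ ℤ.≤ + 26 ℤ.+ T ℤ.* (+ 54 ℤ.+ T ℤ.* (+ 27 ℤ.+ + 4 ℤ.* T))
  P≥0 = ℤP.+-mono-≤ (0≤c 26) (0≤i⇒0≤j⇒0≤i*j 0≤T
          (ℤP.+-mono-≤ (0≤c 54) (0≤i⇒0≤j⇒0≤i*j 0≤T (ℤP.+-mono-≤ (0≤c 27) (0≤i⇒0≤j⇒0≤i*j (0≤c 4) 0≤T)))))
  remainder≥0 : 0ℤ ℤ.≤ (U ℤ.- + 3 ℤ.* a) ℤ.* (U ℤ.- + 3 ℤ.* a)
                 ℤ.+ (+ 26 ℤ.+ T ℤ.* (+ 54 ℤ.+ T ℤ.* (+ 27 ℤ.+ + 4 ℤ.* T))
                 ℤ.+ (+ 4 ℤ.* Q ℤ.- (+ 1 ℤ.+ a ℤ.* a)) ℤ.* (U ℤ.* U))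
  remainder≥0 = ℤP.+-mono-≤ (0≤i*i (U ℤ.- + 3 ℤ.* a))
                  (ℤP.+-mono-≤ P≥0 (0≤i⇒0≤j⇒0≤i*j (ℤP.i≤j⇒0≤j-i 1+a²≤4Q) (0≤i*i U)))

pos-4*cube : ∀ q → + (4 * (q * q * q)) ≡ + 4 ℤ.* (+ q ℤ.* + q ℤ.* + q)
pos-4*cube q = trans (ℤP.pos-* 4 (q * q * q))
                 (cong (+ 4 ℤ.*_) (trans (ℤP.pos-* (q * q) q) (cong (ℤ._* + q) (ℤP.pos-* q q))))

m²<4q⇒[1+a₃]²≤4q³ : ∀ {q m n} → 3 ≤ m → m * m < 4 * q → a₃ q (+ m) ≡ + n →
                     suc n * suc n ≤ 4 * (q * q * q)
m²<4q⇒[1+a₃]²≤4q³ {q} {m} {n} 3≤m m²<4q a₃≡n with ℕP.m≤n⇒∃[o]m+o≡n 3≤m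
... | t , refl = ℤP.drop‿+≤+ (begin
  + (suc n * suc n)                          ≡⟨ ℤP.pos-* (suc n) (suc n) ⟩
  (+ 1 ℤ.+ + n) ℤ.* (+ 1 ℤ.+ + n)            ≡⟨ cong (λ x → (+ 1 ℤ.+ x) ℤ.* (+ 1 ℤ.+ x)) (sym a₃≡n) ⟩
  (+ 1 ℤ.+ a₃ q a) ℤ.* (+ 1 ℤ.+ a₃ q a)      ≤⟨ [1+cubic]²≤4Q³ (+ q) (+ t) (ℤ.+≤+ z≤n) 1+a²≤4q ⟩
  + 4 ℤ.* (+ q ℤ.* + q ℤ.* + q)              ≡⟨ sym (pos-4*cube q) ⟩
  + (4 * (q * q * q))                        ∎)
  where
  open ℤP.≤-Reasoning
  a = + m
  1+a²≤4q : + 1 ℤ.+ a ℤ.* a ℤ.≤ + 4 ℤ.* + q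
  1+a²≤4q = subst₂ ℤ._≤_ (cong (ℤ._+_ (+ 1)) (ℤP.pos-* m m)) (ℤP.pos-* 4 q) (ℤ.+≤+ m²<4q)

[2k]²≡4k² : ∀ k → k * 2 * (k * 2) ≡ 4 * (k * k)
[2k]²≡4k² = ℕSolver.solve-∀

4q≡m²⇒∃[k]q≡k² : ∀ {q m} → 4 * q ≡ m * m → ∃ λ k → q ≡ k * k
4q≡m²⇒∃[k]q≡k² {q} {m} 4q≡m² =
  [ half-is-root , half-is-root ]′ (euclidsLemma m m prime[2] (divides (2 * q) m²≡2q*2))
  where
  m²≡2q*2 : m * m ≡ 2 * q * 2
  m²≡2q*2 = trans (sym 4q≡m²) (trans (ℕP.*-assoc 2 2 q) (ℕP.*-comm 2 (2 * q)))
  half-is-root : 2 ∣ m → ∃ λ k → q ≡ k * k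
  half-is-root (divides k refl) = k , ℕP.*-cancelˡ-≡ q (k * k) 4 (trans 4q≡m² ([2k]²≡4k² k))

3≤⌊2√q⌋ : ∀ {q m n} → 2 ≤ q → 4 * q < suc m * suc m → a₃ q (+ m) ≡ + n → 3 ≤ m
3≤⌊2√q⌋ {m = suc (suc (suc _))} _ _ _ = s≤s (s≤s (s≤s z≤n))
3≤⌊2√q⌋ {m = 0} 2≤q 4q<1 _ = ⊥-elim (ℕP.<⇒≱ 4q<1 (ℕP.≤-trans (ℕP.m≤m+n 1 7) (ℕP.*-monoʳ-≤ 4 2≤q)))
3≤⌊2√q⌋ {m = 1} 2≤q 4q<4 _ = ⊥-elim (ℕP.<⇒≱ 4q<4 (ℕP.≤-trans (ℕP.m≤m+n 4 4) (ℕP.*-monoʳ-≤ 4 2≤q)))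
3≤⌊2√q⌋ {q = 1} {m = 2} (s≤s ()) _ _
3≤⌊2√q⌋ {q = 2} {m = 2} _ _ ()
3≤⌊2√q⌋ {q = suc (suc (suc _))} {m = 2} _ 4q<9 _ =
  ⊥-elim (ℕP.<⇒≱ 4q<9 (ℕP.≤-trans (ℕP.m≤m+n 9 3) (ℕP.*-monoʳ-≤ 4 (s≤s (s≤s (s≤s z≤n))))))

proposition15 : (q : ℕ) → 2 ≤ q → (m n : ℕ) →
    IsFloorSqrt (4 * q) m → IsFloorSqrt (4 * (q * q * q)) n →
    ℤ.- a₃ q (a₁ m) ≡ + n →
    ∃ λ k → q ≡ k * k
proposition15 q 2≤q m n (m²≤4q , 4q<[1+m]²) (_ , 4q³<[1+n]²) -a₃≡n with ℕP.m≤n⇒m<n∨m≡n m²≤4q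
... | inj₂ m²≡4q = 4q≡m²⇒∃[k]q≡k² {q} {m} (sym m²≡4q)
... | inj₁ m²<4q = ⊥-elim (ℕP.<⇒≱ 4q³<[1+n]² (m²<4q⇒[1+a₃]²≤4q³ {q} 3≤m m²<4q a₃≡n))
  where
  a₃≡n : a₃ q (+ m) ≡ + n
  a₃≡n = trans (sym (a₃-odd q (+ m))) -a₃≡n
  3≤m : 3 ≤ m
  3≤m = 3≤⌊2√q⌋ {q} 2≤q 4q<[1+m]² a₃≡n
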